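{- Let $\lambda\ge 2$ and $\mu\ge 3$, and let $T_\lambda$ and $T_\mu$ be trees of diameter $\lambda$ and $\mu$ respectively. Let $n=|V(T_\lambda\times T_\mu)|$. Then $(T_\lambda\times T_\mu)(s_1,\dots,s_n)\in\mathscr{C}_0$ for all integers $s_1,\dots,s_n\ge 2$.
   Context: All graphs are finite and simple; $d(\cdot)$ denotes diameter. For a graph $G$ with vertex set $\{v_1,\dots,v_n\}$ and positive integers $s_1,\dots,s_n$, the vertex-multiplication $G(s_1,\dots,s_n)$ is the graph whose vertex set is a disjoint union $V_1\cup\dots\cup V_n$ with $|V_i|=s_i$, where $u\in V_i$ and $v\in V_j$ are adjacent iff $i\ne j$ and $v_iv_j\in E(G)$. For a connected bridgeless graph $X$, $\bar d(X)$ is the minimum diameter of a strong orientation of $X$. $\mathscr{C}_0$ is the class of all vertex-multiplications $G(s_1,\dots,s_n)$ of a connected graph $G$ with all $s_i\ge 2$ such that $\bar d(G(s_1,\dots,s_n))=d(G)$. The cartesian product $G\times H$ has vertex set $\{\langle u,x\rangle: u\in V(G), x\in V(H)\}$, with $\langle u,x\rangle\langle v,y\rangle$ an edge iff either $u=v$ and $xy\in E(H)$, or $uv\in E(G)$ and $x=y$. -}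

module Defs where

open import Data.Nat using (ℕ; zero; suc; _≤_; _<_)
open import Data.Fin using (Fin; zero; suc; inject₁; fromℕ)
open import Data.Product using (Σ; ∃; _×_; _,_)
open import Data.Sum using (_⊎_)
open import Relation.Nullary using (¬_)
open import Relation.Binary.PropositionalEquality using (_≡_)
open import Function.Definitions using (Injective)

record Graph (V : Set) : Set₁ where
  field
    Adj    : V → V → Set
    sym    : ∀ {u v} → Adj u v → Adj v u
    irrefl : ∀ {v} → ¬ Adj v v
open Graph public

-- Reach R k u v : there is an R-walk from u to v with at most k steps.
data Reach {V : Set} (R : V → V → Set) : ℕ → V → V → Set where
  here : ∀ {k v} → Reach R k v v
  step : ∀ {k u w v} → R u w → Reach R k w v → Reach R (suc k) u v

DiamLE : {V : Set} → (V → V → Set) → ℕ → Set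
DiamLE R k = ∀ u v → Reach R k u v

DiamIs : {V : Set} → (V → V → Set) → ℕ → Set
DiamIs R k = DiamLE R k × (∀ j → j < k → ¬ DiamLE R j)

HasDiam : {V : Set} → Graph V → ℕ → Set
HasDiam G k = DiamIs (Adj G) k

Connected : {V : Set} → Graph V → Set
Connected G = ∀ u v → ∃ λ k → Reach (Adj G) k u v

-- a cycle of length 3+k: injective cyclic sequence of adjacent vertices
IsCycle : {V : Set} → Graph V → (k : ℕ) → (Fin (suc (suc (suc k))) → V) → Set
IsCycle G k c =
  Injective _≡_ _≡_ c ×
  (∀ (i : Fin (suc (suc k))) → Adj G (c (inject₁ i)) (c (suc i))) ×
  Adj G (c (fromℕ (suc (suc k)))) (c zero)

Acyclic : {V : Set} → Graph V → Set
Acyclic G = ∀ k c → ¬ IsCycle G k c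

IsTree : {V : Set} → Graph V → Set
IsTree G = Connected G × Acyclic G

IsOrientation : {V : Set} → Graph V → (V → V → Set) → Set
IsOrientation G D =
  (∀ {u v} → D u v → Adj G u v) ×
  (∀ {u v} → Adj G u v → D u v ⊎ D v u) ×
  (∀ {u v} → ¬ (D u v × D v u))

IsStrongOrientation : {V : Set} → Graph V → (V → V → Set) → Set
IsStrongOrientation G D =
  IsOrientation G D × (∀ u v → ∃ λ k → Reach D k u v)

OrientedDiamIs : {V : Set} → Graph V → ℕ → Set₁
OrientedDiamIs {V} G k =
  (Σ (V → V → Set) λ D → IsStrongOrientation G D × DiamIs D k) ×
  (∀ (D : V → V → Set) → IsStrongOrientation G D → ∀ j → j < k → ¬ DiamLE D j)

_□_ : {V W : Set} → Graph V → Graph W → Graph (V × W)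
_□_ {V} {W} G H = record { Adj = A ; sym = s ; irrefl = i }
  where
  A : V × W → V × W → Set
  A (u , x) (v , y) = (u ≡ v × Adj H x y) ⊎ (Adj G u v × x ≡ y)
  open import Relation.Binary.PropositionalEquality using (refl)
  open import Data.Sum using (inj₁; inj₂)
  s : ∀ {p q} → A p q → A q p
  s (inj₁ (refl , h)) = inj₁ (refl , Graph.sym H h)
  s (inj₂ (g , refl)) = inj₂ (Graph.sym G g , refl)
  i : ∀ {p} → ¬ A p p
  i (inj₁ (_ , h)) = Graph.irrefl H h
  i (inj₂ (g , _)) = Graph.irrefl G g

-- vertex multiplication G(s): vertex v replaced by s v independent copies
Mult : {V : Set} → Graph V → (s : V → ℕ) → Graph (Σ V (λ v → Fin (s v)))
Mult {V} G s = record { Adj = A ; sym = λ {p} {q} → Graph.sym G ; irrefl = Graph.irrefl G }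
  where
  A : Σ V (λ v → Fin (s v)) → Σ V (λ v → Fin (s v)) → Set
  A (u , _) (v , _) = Adj G u v

InC₀ : {V : Set} → Graph V → (V → ℕ) → Set₁
InC₀ G s =
  Connected G × (∀ v → 2 ≤ s v) ×
  Σ ℕ (λ k → HasDiam G k × OrientedDiamIs (Mult G s) k)

-- Give the copies of every vertex a parity (the first copy 0, the others 1) and fix an
-- orientation σ of the base graph T₁ □ T₂. Orient an edge between copies along σ when the
-- copies have equal parity and against σ otherwise. A base walk then lifts between any two
-- prescribed copies exactly when its σ-parity (the sum of σ over its steps) matches
-- the parities of the end copies, so it suffices to join any two base vertices by two walks
-- of length ≤ d(T₁) + d(T₂) = d(T₁ □ T₂) of opposite σ-parity. A shortest walk using both
-- factors has such a partner: exchange its first steps in the two factors. For this, σ on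
-- T₁-edges is twisted by a proper 2-colouring of T₂, which is where T₂ being a tree is used
-- (T₁ may be any graph). Otherwise, prepend a step back and forth. No orientation can do
-- better, since it projects onto T₁ □ T₂.
module Submission where

open import Defs hiding (sym)
open import Data.Nat using (ℕ; zero; suc; _+_; _≤_; _<_; z≤n; s≤s; s≤s⁻¹; _≤?_; parity)
open import Data.Nat.Properties
  using (+-suc; +-comm; ≤-trans; ≤-refl; ≤-reflexive; m≤m+n; m≤n+m; n≤1+n; +-mono-≤; +-monoˡ-≤;
         +-monoʳ-≤; +-monoˡ-<; +-cancelˡ-≤; m<m+n; m<n+m; <-≤-trans; ≰⇒>; module ≤-Reasoning)
open import Data.Nat.Induction using (<-rec)
open import Data.Parity.Base using (Parity; 0ℙ; 1ℙ; _⁻¹) renaming (_+_ to _⊕_)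
open import Data.Parity.Properties
  using (_≟_; p≢p⁻¹; p+p⁻¹≡1ℙ; p+p≡0ℙ; +-cancelˡ-≡; +-homo-+; suc-homo-⁻¹;
         +-*-commutativeRing)
  renaming (+-assoc to ⊕-assoc; +-identityʳ to ⊕-identityʳ)
open import Data.Fin using (Fin; zero; suc; inject₁; fromℕ; toℕ)
open import Data.Fin.Properties using (any?; ¬∀⟶∃¬; _<?_; <-cmp; sequence)
  renaming (_≟_ to _≟ᶠ_)
open import Data.Product using (Σ; ∃; ∃₂; _×_; _,_; proj₁; proj₂)
open import Data.Sum using (_⊎_; inj₁; inj₂; [_,_]′; swap)
import Data.Sum.Effectful.Left as SumLeft
open import Data.Empty using (⊥-elim)
open import Data.Bool using (if_then_else_)
open import Data.Maybe using (nothing)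
open import Level using (0ℓ)
open import Relation.Nullary using (¬_; yes; no; does; contradiction)
open import Relation.Nullary.Decidable using (dec-true; dec-false)
open import Relation.Binary.Definitions using (tri<; tri≈; tri>)
open import Relation.Binary.PropositionalEquality
  using (_≡_; _≢_; refl; sym; trans; cong; cong₂; subst; subst₂; module ≡-Reasoning)
open import Function.Definitions using (Injective)
open import Tactic.RingSolver using (solve-∀)
open import Tactic.RingSolver.Core.AlmostCommutativeRing using (fromCommutativeRing)

≢⇒≡⁻¹ : ∀ {p q : Parity} → p ≢ q → p ≡ q ⁻¹
≢⇒≡⁻¹ {0ℙ} {0ℙ} p≢q = contradiction refl p≢q
≢⇒≡⁻¹ {0ℙ} {1ℙ} _   = refl
≢⇒≡⁻¹ {1ℙ} {0ℙ} _   = refl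
≢⇒≡⁻¹ {1ℙ} {1ℙ} p≢q = contradiction refl p≢q

⁻¹-⊕ : ∀ p q → p ⁻¹ ⊕ q ≡ (p ⊕ q) ⁻¹
⁻¹-⊕ = ⊕-assoc 1ℙ

⊕-⁻¹ : ∀ p q → p ⊕ q ⁻¹ ≡ (p ⊕ q) ⁻¹
⊕-⁻¹ 0ℙ q = refl
⊕-⁻¹ 1ℙ q = refl

⊕-⊕⁻¹ : ∀ p q → p ⊕ q ⊕ q ⁻¹ ≡ p ⁻¹
⊕-⊕⁻¹ 0ℙ 0ℙ = refl
⊕-⊕⁻¹ 0ℙ 1ℙ = refl
⊕-⊕⁻¹ 1ℙ 0ℙ = refl
⊕-⊕⁻¹ 1ℙ 1ℙ = refl

⁻¹-⊕-⊕⁻¹ : ∀ p q → (p ⊕ q) ⁻¹ ⊕ q ⁻¹ ≡ p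
⁻¹-⊕-⊕⁻¹ 0ℙ 0ℙ = refl
⁻¹-⊕-⊕⁻¹ 0ℙ 1ℙ = refl
⁻¹-⊕-⊕⁻¹ 1ℙ 0ℙ = refl
⁻¹-⊕-⊕⁻¹ 1ℙ 1ℙ = refl

-- p ⁻¹ is 1ℙ ⊕ p by definition, so this is an identity of commutative rings.
⊕-exchange-⁻¹ : ∀ a b c t → b ⊕ (a ⊕ c ⁻¹ ⊕ t) ≡ (a ⊕ c ⊕ (b ⊕ t)) ⁻¹
⊕-exchange-⁻¹ = exchange
  where
  parityRing = fromCommutativeRing +-*-commutativeRing (λ _ → nothing)
  exchange : ∀ a b c t → b ⊕ (a ⊕ (1ℙ ⊕ c) ⊕ t) ≡ 1ℙ ⊕ (a ⊕ c ⊕ (b ⊕ t))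
  exchange = solve-∀ parityRing

parity-remove-even : ∀ a b c → parity (a + c) ≡ 0ℙ → parity b ≡ 0ℙ → parity (a + b + c) ≡ 0ℙ
parity-remove-even a b c even-ac even-b = begin
  parity (a + b + c)              ≡⟨ +-homo-+ (a + b) c ⟩
  parity (a + b) ⊕ parity c       ≡⟨ cong (_⊕ parity c) (+-homo-+ a b) ⟩
  parity a ⊕ parity b ⊕ parity c  ≡⟨ cong (λ x → parity a ⊕ x ⊕ parity c) even-b ⟩
  parity a ⊕ 0ℙ ⊕ parity c        ≡⟨ cong (_⊕ parity c) (⊕-identityʳ (parity a)) ⟩
  parity a ⊕ parity c             ≡⟨ +-homo-+ a c ⟨
  parity (a + c)                  ≡⟨ even-ac ⟩
  0ℙ                              ∎
  where open ≡-Reasoning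

≤-+-cases : ∀ {m n k l} → m + n ≤ k + suc l → m ≤ k ⊎ n ≤ l
≤-+-cases {m} {n} {k} {l} m+n≤k+1+l with m ≤? k
... | yes m≤k = inj₁ m≤k
... | no m≰k = inj₂ (+-cancelˡ-≤ (suc k) n l (begin
  suc k + n  ≤⟨ +-monoˡ-≤ n (≰⇒> m≰k) ⟩
  m + n      ≤⟨ m+n≤k+1+l ⟩
  k + suc l  ≡⟨ +-suc k l ⟩
  suc k + l  ∎))
  where open ≤-Reasoning

Fin-∀²-⊎ : ∀ {m n} {Q : Set} {P : Fin m → Fin n → Set} →
           (∀ i j → Q ⊎ P i j) → Q ⊎ (∀ i j → P i j)
Fin-∀²-⊎ {Q = Q} f = sequence applicative (λ i → sequence applicative (f i))
  where open SumLeft Q 0ℓ using (applicative)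

module _ {V : Set} {R : V → V → Set} where

  Reach-weaken : ∀ {k l u v} → k ≤ l → Reach R k u v → Reach R l u v
  Reach-weaken _         here       = here
  Reach-weaken (s≤s k≤l) (step r w) = step r (Reach-weaken k≤l w)

  Reach-trans : ∀ {k l u v w} → Reach R k u v → Reach R l v w → Reach R (k + l) u w
  Reach-trans {k} here       w′ = Reach-weaken (m≤n+m _ k) w′
  Reach-trans     (step r w) w′ = step r (Reach-trans w w′)

  DiamLE-weaken : ∀ {k l} → k ≤ l → DiamLE R k → DiamLE R l
  DiamLE-weaken k≤l d u v = Reach-weaken k≤l (d u v)

  all≡⇒DiamLE0 : ∀ {x} → (∀ y → y ≡ x) → DiamLE R 0
  all≡⇒DiamLE0 all≡x u v = subst₂ (Reach R 0) (sym (all≡x u)) (sym (all≡x v)) here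

  Reach-first-step : ∀ {k u v} → Reach R k u v → u ≢ v → ∃ (R u)
  Reach-first-step here       u≢u = contradiction refl u≢u
  Reach-first-step (step r _) _   = _ , r

Reach-map : ∀ {V W : Set} {R : V → V → Set} {S : W → W → Set} (f : V → W) →
            (∀ {u v} → R u v → S (f u) (f v)) → ∀ {k u v} → Reach R k u v → Reach S k (f u) (f v)
Reach-map f R⇒S here       = here
Reach-map f R⇒S (step r w) = step (R⇒S r) (Reach-map f R⇒S w)

neighbour : ∀ {n k} (G : Graph (Fin n)) → HasDiam G (suc k) → ∀ x → ∃ (Adj G x)
neighbour G (diam , minimal) x
  with y , y≢x ← ¬∀⟶∃¬ _ (_≡ x) (_≟ᶠ x) (λ all≡x → minimal 0 (s≤s z≤n) (all≡⇒DiamLE0 all≡x))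
  = Reach-first-step (diam x y) (λ x≡y → y≢x (sym x≡y))

infixr 5 _∷_

data Walk {V : Set} (R : V → V → Set) : V → V → ℕ → Set where
  []  : ∀ {v} → Walk R v v 0
  _∷_ : ∀ {u w v n} → R u w → Walk R w v n → Walk R u v (suc n)

module _ {V : Set} {R : V → V → Set} where

  infixr 5 _++_

  _++_ : ∀ {u v w m n} → Walk R u v m → Walk R v w n → Walk R u w (m + n)
  []      ++ w′ = w′
  (r ∷ w) ++ w′ = r ∷ (w ++ w′)

  _∷ʳ_ : ∀ {u v w n} → Walk R u v n → R v w → Walk R u w (suc n)
  []      ∷ʳ r′ = r′ ∷ []
  (r ∷ w) ∷ʳ r′ = r ∷ (w ∷ʳ r′)

  Reach⇒Walk : ∀ {k u v} → Reach R k u v → ∃ (Walk R u v)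
  Reach⇒Walk here       = 0 , []
  Reach⇒Walk (step r w) = let n , w′ = Reach⇒Walk w in suc n , r ∷ w′

  -- visits w i is the vertex reached after i + 1 steps
  visits : ∀ {u v n} → Walk R u v n → Fin n → V
  visits (_∷_ {w = x} _ _) zero    = x
  visits (_ ∷ w)           (suc i) = visits w i

  visits-last : ∀ {u v n} (w : Walk R u v (suc n)) → visits w (fromℕ n) ≡ v
  visits-last (_ ∷ [])      = refl
  visits-last (_ ∷ w@(_ ∷ _)) = visits-last w

  visits-step : ∀ {u v n} (w : Walk R u v (suc n)) (i : Fin n) →
                R (visits w (inject₁ i)) (visits w (suc i))
  visits-step (_ ∷ r ∷ _)     zero    = r
  visits-step (_ ∷ w@(_ ∷ _)) (suc i) = visits-step w i

  splitAfter : ∀ {u v n} (w : Walk R u v n) (i : Fin n) →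
               ∃ λ l → Walk R u (visits w i) (suc (toℕ i)) × Walk R (visits w i) v l ×
                       suc (toℕ i) + l ≡ n
  splitAfter (r ∷ w) zero    = _ , r ∷ [] , w , refl
  splitAfter (r ∷ w) (suc i) = let l , w₁ , w₂ , eq = splitAfter w i in
                               l , r ∷ w₁ , w₂ , cong suc eq

-- The prefix is nonempty, so both the loop and the walk without it are shorter.
data Detour {V : Set} (R : V → V → Set) (u v : V) (n : ℕ) : Set where
  detour : ∀ {z k m l} → Walk R u z (suc k) → Walk R z z (suc m) → Walk R z v l →
           suc k + suc m + l ≡ n → Detour R u v n

module _ {n : ℕ} (G : Graph (Fin n)) where

  private
    R = Adj G

  reverse : ∀ {u v k} → Walk R u v k → Walk R v u k
  reverse []      = []
  reverse (r ∷ w) = reverse w ∷ʳ Graph.sym G r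

  visits-∷-injective : ∀ {u x v k} (r : R u x) (w : Walk R x v k) →
                       ¬ (∃ λ i → visits w i ≡ x) → Injective _≡_ _≡_ (visits w) →
                       Injective _≡_ _≡_ (visits (r ∷ w))
  visits-∷-injective r w x∉w inj {zero}  {zero}  _  = refl
  visits-∷-injective r w x∉w inj {zero}  {suc j} eq = contradiction (j , sym eq) x∉w
  visits-∷-injective r w x∉w inj {suc i} {zero}  eq = contradiction (i , eq) x∉w
  visits-∷-injective r w x∉w inj {suc i} {suc j} eq = cong suc (inj eq)

  detour-or-injective : ∀ {u v k} (w : Walk R u v k) → Detour R u v k ⊎ Injective _≡_ _≡_ (visits w)
  detour-or-injective []                = inj₂ λ { {()} }
  detour-or-injective (_∷_ {w = x} r w) with detour-or-injective w
  ... | inj₁ (detour w₁ loop w₂ eq) = inj₁ (detour (r ∷ w₁) loop w₂ (cong suc eq))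
  ... | inj₂ inj with any? (λ i → visits w i ≟ᶠ x)
  ...   | no x∉w = inj₂ (visits-∷-injective r w x∉w inj)
  ...   | yes (i , xᵢ≡x) with splitAfter w i
  ...     | l , w₁ , w₂ , eq =
    inj₁ (detour (r ∷ []) (subst (λ z → Walk R x z _) xᵢ≡x w₁) (subst (λ z → Walk R z _ l) xᵢ≡x w₂)
                 (cong suc eq))

  injective-closed-walk-even : Acyclic G → ∀ {v k} (w : Walk R v v k) →
                               Injective _≡_ _≡_ (visits w) → parity k ≡ 0ℙ
  injective-closed-walk-even _ []          _ = refl
  injective-closed-walk-even _ (r ∷ [])    _ = contradiction r (Graph.irrefl G)
  injective-closed-walk-even _ (_ ∷ _ ∷ []) _ = refl
  injective-closed-walk-even acyclic w@(r ∷ _ ∷ _ ∷ _) inj =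
    ⊥-elim (acyclic _ (visits w)
              (inj , visits-step w , subst (λ z → R z (visits w zero)) (sym (visits-last w)) r))

  closed-walk-even : Acyclic G → ∀ {v k} → Walk R v v k → parity k ≡ 0ℙ
  closed-walk-even acyclic {k = k} = <-rec (λ k → ∀ {v} → Walk R v v k → parity k ≡ 0ℙ) even k
    where
    even : ∀ k → (∀ {j} → j < k → ∀ {v} → Walk R v v j → parity j ≡ 0ℙ) →
           ∀ {v} → Walk R v v k → parity k ≡ 0ℙ
    even k rec w with detour-or-injective w
    ... | inj₂ inj = injective-closed-walk-even acyclic w inj
    ... | inj₁ (detour {k = a} {m} {l} w₁ loop w₂ refl) =
      parity-remove-even (suc a) (suc m) l
        (rec (+-monoˡ-< l (m<m+n (suc a) (s≤s z≤n))) (w₁ ++ w₂))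
        (rec (<-≤-trans (m<n+m (suc m) (s≤s z≤n)) (m≤m+n (suc a + suc m) l)) loop)

IsProperColouring : ∀ {V : Set} → Graph V → (V → Parity) → Set
IsProperColouring G c = ∀ {x y} → Adj G x y → c y ≡ c x ⁻¹

module _ {n : ℕ} (G : Graph (Fin n)) (connected : Connected G) (acyclic : Acyclic G)
         (root : Fin n) where

  private
    walkFromRoot : ∀ x → ∃ (Walk (Adj G) root x)
    walkFromRoot x = Reach⇒Walk (proj₂ (connected root x))

  distanceParity : Fin n → Parity
  distanceParity x = parity (proj₁ (walkFromRoot x))

  distanceParity-proper : IsProperColouring G distanceParity
  distanceParity-proper {x} {y} r = begin
    parity m              ≡⟨ suc-homo-⁻¹ m ⟨
    parity (suc m) ⁻¹     ≡⟨ cong _⁻¹ 1+m≡k ⟩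
    parity k ⁻¹           ∎
    where
    open ≡-Reasoning
    k = proj₁ (walkFromRoot x)
    m = proj₁ (walkFromRoot y)
    closed-even : parity k ⊕ parity (suc m) ≡ 0ℙ
    closed-even = trans (sym (+-homo-+ k (suc m)))
                (closed-walk-even G acyclic
                   (proj₂ (walkFromRoot x) ++ r ∷ reverse G (proj₂ (walkFromRoot y))))
    1+m≡k : parity (suc m) ≡ parity k
    1+m≡k = +-cancelˡ-≡ (parity k) _ _ (trans closed-even (sym (p+p≡0ℙ (parity k))))

tree-colouring : ∀ {n} (G : Graph (Fin n)) → IsTree G → Σ (Fin n → Parity) (IsProperColouring G)
tree-colouring {zero}  G _                      = (λ ()) , λ { {()} }
tree-colouring {suc n} G (connected , acyclic) =
  distanceParity G connected acyclic zero , distanceParity-proper G connected acyclic zero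

module _ {V₁ V₂ : Set} (G₁ : Graph V₁) (G₂ : Graph V₂) where

  private
    R = Adj (G₁ □ G₂)

  Reach-□ˡ : ∀ {k u v} x → Reach (Adj G₁) k u v → Reach R k (u , x) (v , x)
  Reach-□ˡ x = Reach-map (_, x) (λ r → inj₂ (r , refl))

  Reach-□ʳ : ∀ {k x y} u → Reach (Adj G₂) k x y → Reach R k (u , x) (u , y)
  Reach-□ʳ u = Reach-map (u ,_) (λ r → inj₁ (refl , r))

  DiamLE-□ : ∀ {k l} → DiamLE (Adj G₁) k → DiamLE (Adj G₂) l → DiamLE R (k + l)
  DiamLE-□ d₁ d₂ (u , x) (v , y) = Reach-trans (Reach-□ˡ x (d₁ u v)) (Reach-□ʳ v (d₂ x y))

  Reach-□-split : ∀ {k u v x y} → Reach R k (u , x) (v , y) →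
                  ∃₂ λ k₁ k₂ → k₁ + k₂ ≤ k × Reach (Adj G₁) k₁ u v × Reach (Adj G₂) k₂ x y
  Reach-□-split here = 0 , 0 , z≤n , here , here
  Reach-□-split (step (inj₁ (refl , r)) w) =
    let k₁ , k₂ , k₁+k₂≤k , w₁ , w₂ = Reach-□-split w in
    k₁ , suc k₂ , ≤-trans (≤-reflexive (+-suc k₁ k₂)) (s≤s k₁+k₂≤k) , w₁ , step r w₂
  Reach-□-split (step (inj₂ (r , refl)) w) =
    let k₁ , k₂ , k₁+k₂≤k , w₁ , w₂ = Reach-□-split w in
    suc k₁ , k₂ , s≤s k₁+k₂≤k , step r w₁ , w₂

module _ {a b : ℕ} (G₁ : Graph (Fin a)) (G₂ : Graph (Fin b)) where

  ¬DiamLE-□ : ∀ {k l} → ¬ DiamLE (Adj G₁) k → ¬ DiamLE (Adj G₂) l →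
              ¬ DiamLE (Adj (G₁ □ G₂)) (k + suc l)
  ¬DiamLE-□ {k} {l} ¬d₁ ¬d₂ d =
    [ ¬d₁ , ¬d₂ ]′ (Fin-∀²-⊎ λ x y → swap (Fin-∀²-⊎ λ u v → swap (short-in-a-factor u v x y)))
    where
    short-in-a-factor : ∀ u v x y → Reach (Adj G₁) k u v ⊎ Reach (Adj G₂) l x y
    short-in-a-factor u v x y with Reach-□-split G₁ G₂ (d (u , x) (v , y))
    ... | k₁ , k₂ , k₁+k₂≤ , w₁ , w₂ with ≤-+-cases k₁+k₂≤
    ...   | inj₁ k₁≤k = inj₁ (Reach-weaken k₁≤k w₁)
    ...   | inj₂ k₂≤l = inj₂ (Reach-weaken k₂≤l w₂)

  HasDiam-□ : ∀ {k l} → HasDiam G₁ (suc k) → HasDiam G₂ (suc l) → HasDiam (G₁ □ G₂) (suc k + suc l)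
  HasDiam-□ {k} {l} (d₁ , minimal₁) (d₂ , minimal₂) =
    DiamLE-□ G₁ G₂ d₁ d₂ ,
    λ j j<k+l d → ¬DiamLE-□ (minimal₁ k ≤-refl) (minimal₂ l ≤-refl) (DiamLE-weaken (s≤s⁻¹ j<k+l) d)

copyParity : ∀ {k} → Fin k → Parity
copyParity zero    = 0ℙ
copyParity (suc _) = 1ℙ

copyOfParity : ∀ {k} → 2 ≤ k → Parity → Fin k
copyOfParity (s≤s (s≤s _)) 0ℙ = zero
copyOfParity (s≤s (s≤s _)) 1ℙ = suc zero

copyParity-copyOfParity : ∀ {k} (2≤k : 2 ≤ k) p → copyParity (copyOfParity 2≤k p) ≡ p
copyParity-copyOfParity (s≤s (s≤s _)) 0ℙ = refl
copyParity-copyOfParity (s≤s (s≤s _)) 1ℙ = refl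

module _ {V : Set} (G : Graph V) {s : V → ℕ} where

  private
    Copy = Σ V (λ v → Fin (s v))

  DiamLE-Mult⇒DiamLE : (∀ v → Fin (s v)) → {R : Copy → Copy → Set} →
                       (∀ {P Q} → R P Q → Adj (Mult G s) P Q) →
                       ∀ {k} → DiamLE R k → DiamLE (Adj G) k
  DiamLE-Mult⇒DiamLE copy R⊆Adj d u v = Reach-map proj₁ R⊆Adj (d (u , copy u) (v , copy v))

  orientation⇒InC₀ : ∀ {k} → (∀ v → 2 ≤ s v) → HasDiam G k →
                     (D : Copy → Copy → Set) → IsOrientation (Mult G s) D → DiamLE D k → InC₀ G s
  orientation⇒InC₀ {k} s≥2 (diam , minimal) D orientation diamD =
    (λ u v → k , diam u v) , s≥2 , k , (diam , minimal) ,
    (D , (orientation , λ P Q → k , diamD P Q) , diamD , no-shorter (proj₁ orientation)) ,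
    λ D′ strong → no-shorter (proj₁ (proj₁ strong))
    where
    no-shorter : ∀ {R : Copy → Copy → Set} → (∀ {P Q} → R P Q → Adj (Mult G s) P Q) →
                 ∀ j → j < k → ¬ DiamLE R j
    no-shorter R⊆Adj j j<k d =
      minimal j j<k (DiamLE-Mult⇒DiamLE (λ v → copyOfParity (s≥2 v) 0ℙ) R⊆Adj d)

IsEdgeSign : ∀ {V : Set} → Graph V → (V → V → Parity) → Set
IsEdgeSign G σ = ∀ {p q} → Adj G p q → σ q p ≡ σ p q ⁻¹

module SignedWalks {V : Set} (G : Graph V) {σ : V → V → Parity} (σ-flip : IsEdgeSign G σ) where

  sign : ∀ {k p q} → Reach (Adj G) k p q → Parity
  sign here                       = 0ℙ
  sign (step {u = p} {w = r} _ w) = σ p r ⊕ sign w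

  sign-backtrack : ∀ {k p q v} (r : Adj G p q) (r′ : Adj G q p) (w : Reach (Adj G) k p v) →
                   sign (step r (step r′ w)) ≡ sign w ⁻¹
  sign-backtrack {p = p} {q} r r′ w = begin
    σ p q ⊕ (σ q p ⊕ sign w)      ≡⟨ cong (λ x → σ p q ⊕ (x ⊕ sign w)) (σ-flip r) ⟩
    σ p q ⊕ (σ p q ⁻¹ ⊕ sign w)   ≡⟨ ⊕-assoc (σ p q) (σ p q ⁻¹) (sign w) ⟨
    σ p q ⊕ σ p q ⁻¹ ⊕ sign w     ≡⟨ cong (_⊕ sign w) (p+p⁻¹≡1ℙ (σ p q)) ⟩
    sign w ⁻¹                     ∎
    where open ≡-Reasoning

  module MultOrientation (s : V → ℕ) (s≥2 : ∀ v → 2 ≤ s v) where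

    private
      Copy = Σ V (λ v → Fin (s v))

    Arc : Copy → Copy → Set
    Arc (p , i) (q , j) = Adj G p q × copyParity j ≡ copyParity i ⊕ σ p q

    Arc-isOrientation : IsOrientation (Mult G s) Arc
    Arc-isOrientation = proj₁ , total , antisymmetric
      where
      total : ∀ {P Q} → Adj (Mult G s) P Q → Arc P Q ⊎ Arc Q P
      total {p , i} {q , j} r with copyParity j ≟ copyParity i ⊕ σ p q
      ... | yes j≡i⊕σ = inj₁ (r , j≡i⊕σ)
      ... | no j≢i⊕σ = inj₂ (Graph.sym G r , (begin
        copyParity i                      ≡⟨ ⁻¹-⊕-⊕⁻¹ (copyParity i) (σ p q) ⟨
        (copyParity i ⊕ σ p q) ⁻¹ ⊕ σ p q ⁻¹ ≡⟨ cong₂ _⊕_ (≢⇒≡⁻¹ j≢i⊕σ) (σ-flip r) ⟨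
        copyParity j ⊕ σ q p              ∎))
        where open ≡-Reasoning
      antisymmetric : ∀ {P Q} → ¬ (Arc P Q × Arc Q P)
      antisymmetric {p , i} {q , j} ((r , j≡i⊕σ) , (_ , i≡j⊕σ′)) = p≢p⁻¹ (copyParity i) (begin
        copyParity i                      ≡⟨ i≡j⊕σ′ ⟩
        copyParity j ⊕ σ q p              ≡⟨ cong₂ _⊕_ j≡i⊕σ (σ-flip r) ⟩
        copyParity i ⊕ σ p q ⊕ σ p q ⁻¹   ≡⟨ ⊕-⊕⁻¹ (copyParity i) (σ p q) ⟩
        copyParity i ⁻¹                   ∎)
        where open ≡-Reasoning

    lift : ∀ {k p r q} (a : Adj G p r) (w : Reach (Adj G) k r q) i j →
           copyParity j ≡ copyParity i ⊕ sign (step a w) → Reach Arc (suc k) (p , i) (q , j)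
    lift {p = p} {q = q} a here i j j≡i⊕sign =
      step (a , trans j≡i⊕sign (cong (copyParity i ⊕_) (⊕-identityʳ (σ p q)))) here
    lift {p = p} {r} a (step b w) i j j≡i⊕sign =
      step (a , c-parity) (lift b w c j (begin
        copyParity j                               ≡⟨ j≡i⊕sign ⟩
        copyParity i ⊕ (σ p r ⊕ sign (step b w))   ≡⟨ ⊕-assoc (copyParity i) (σ p r) _ ⟨
        copyParity i ⊕ σ p r ⊕ sign (step b w)     ≡⟨ cong (_⊕ sign (step b w)) c-parity ⟨
        copyParity c ⊕ sign (step b w)             ∎))
      where
      open ≡-Reasoning
      c = copyOfParity (s≥2 r) (copyParity i ⊕ σ p r)
      c-parity : copyParity c ≡ copyParity i ⊕ σ p r
      c-parity = copyParity-copyOfParity (s≥2 r) _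

    reach-all-copies : ∀ {L k k′ p r r′ q} (a : Adj G p r) (w : Reach (Adj G) k r q)
                       (a′ : Adj G p r′) (w′ : Reach (Adj G) k′ r′ q) → suc k ≤ L → suc k′ ≤ L →
                       sign (step a′ w′) ≡ sign (step a w) ⁻¹ → ∀ i j → Reach Arc L (p , i) (q , j)
    reach-all-copies a w a′ w′ k<L k′<L opposite i j
      with copyParity j ≟ copyParity i ⊕ sign (step a w)
    ... | yes j≡i⊕sign = Reach-weaken k<L (lift a w i j j≡i⊕sign)
    ... | no j≢i⊕sign = Reach-weaken k′<L (lift a′ w′ i j (begin
      copyParity j                            ≡⟨ ≢⇒≡⁻¹ j≢i⊕sign ⟩
      (copyParity i ⊕ sign (step a w)) ⁻¹     ≡⟨ ⊕-⁻¹ (copyParity i) (sign (step a w)) ⟨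
      copyParity i ⊕ sign (step a w) ⁻¹       ≡⟨ cong (copyParity i ⊕_) opposite ⟨
      copyParity i ⊕ sign (step a′ w′)        ∎))
      where open ≡-Reasoning

    reach-all-copies-by-backtracking : (∀ v → ∃ (Adj G v)) → ∀ {L l p q} → Reach (Adj G) l p q →
                                       2 + l ≤ L → 4 ≤ L → ∀ i j → Reach Arc L (p , i) (q , j)
    reach-all-copies-by-backtracking hasNeighbour {p = p} here _ 4≤L =
      reach-all-copies a back a (step a′ (step a back)) (≤-trans (s≤s (s≤s z≤n)) 4≤L) 4≤L
                       (sign-backtrack a a′ (step a back))
      where
      a = proj₂ (hasNeighbour p)
      a′ = Graph.sym G a
      back : Reach (Adj G) 1 (proj₁ (hasNeighbour p)) p
      back = step a′ here
    reach-all-copies-by-backtracking hasNeighbour {p = p} (step b w) 2+l≤L _ =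
      reach-all-copies b w a (step a′ (step b w)) (≤-trans (m≤n+m _ 2) 2+l≤L) 2+l≤L
                       (sign-backtrack a a′ (step b w))
      where
      a = proj₂ (hasNeighbour p)
      a′ = Graph.sym G a

Adj⇒≢ : ∀ {V : Set} (G : Graph V) {u v} → Adj G u v → u ≢ v
Adj⇒≢ G r refl = Graph.irrefl G r

orderSign : ∀ {n} → Fin n → Fin n → Parity
orderSign x y = if does (x <? y) then 1ℙ else 0ℙ

orderSign-isEdgeSign : ∀ {n} (G : Graph (Fin n)) → IsEdgeSign G orderSign
orderSign-isEdgeSign G {x} {y} r with <-cmp x y
... | tri< x<y _ y≮x rewrite dec-true (x <? y) x<y | dec-false (y <? x) y≮x = refl
... | tri≈ _ x≡y _   = contradiction x≡y (Adj⇒≢ G r)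
... | tri> x≮y _ y<x rewrite dec-false (x <? y) x≮y | dec-true (y <? x) y<x = refl

module ProductSign {a b : ℕ} (G₁ : Graph (Fin a)) (G₂ : Graph (Fin b))
                   {c : Fin b → Parity} (c-proper : IsProperColouring G₂ c) where

  -- Twisting horizontal edges by the colouring of G₂ makes every square of G₁ □ G₂ odd.
  □-sign : Fin a × Fin b → Fin a × Fin b → Parity
  □-sign (u , x) (v , y) = if does (u ≟ᶠ v) then orderSign x y else orderSign u v ⊕ c x

  □-sign-vertical : ∀ u x y → □-sign (u , x) (u , y) ≡ orderSign x y
  □-sign-vertical u x y rewrite dec-true (u ≟ᶠ u) refl = refl

  □-sign-horizontal : ∀ {u v} x → u ≢ v → □-sign (u , x) (v , x) ≡ orderSign u v ⊕ c x
  □-sign-horizontal {u} {v} x u≢v rewrite dec-false (u ≟ᶠ v) u≢v = refl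

  □-sign-isEdgeSign : IsEdgeSign (G₁ □ G₂) □-sign
  □-sign-isEdgeSign {u , x} {_ , y} (inj₁ (refl , r)) = begin
    □-sign (u , y) (u , x)        ≡⟨ □-sign-vertical u y x ⟩
    orderSign y x                 ≡⟨ orderSign-isEdgeSign G₂ r ⟩
    orderSign x y ⁻¹              ≡⟨ cong _⁻¹ (□-sign-vertical u x y) ⟨
    □-sign (u , x) (u , y) ⁻¹     ∎
    where open ≡-Reasoning
  □-sign-isEdgeSign {u , x} {v , _} (inj₂ (r , refl)) = begin
    □-sign (v , x) (u , x)        ≡⟨ □-sign-horizontal x (Adj⇒≢ G₁ (Graph.sym G₁ r)) ⟩
    orderSign v u ⊕ c x           ≡⟨ cong (_⊕ c x) (orderSign-isEdgeSign G₁ r) ⟩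
    orderSign u v ⁻¹ ⊕ c x        ≡⟨ ⁻¹-⊕ (orderSign u v) (c x) ⟩
    (orderSign u v ⊕ c x) ⁻¹      ≡⟨ cong _⁻¹ (□-sign-horizontal x (Adj⇒≢ G₁ r)) ⟨
    □-sign (u , x) (v , x) ⁻¹     ∎
    where open ≡-Reasoning

  open SignedWalks (G₁ □ G₂) □-sign-isEdgeSign public

  sign-exchange : ∀ {k u u′ x x′ q} (r₁ : Adj G₁ u u′) (r₂ : Adj G₂ x x′)
                  (w : Reach (Adj (G₁ □ G₂)) k (u′ , x′) q) →
                  sign (step (inj₁ (refl , r₂)) (step (inj₂ (r₁ , refl)) w)) ≡
                  sign (step (inj₂ (r₁ , refl)) (step (inj₁ (refl , r₂)) w)) ⁻¹
  sign-exchange {u = u} {u′} {x} {x′} r₁ r₂ w = begin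
    □-sign (u , x) (u , x′) ⊕ (□-sign (u , x′) (u′ , x′) ⊕ sign w)
      ≡⟨ cong₂ (λ s t → s ⊕ (t ⊕ sign w)) (□-sign-vertical u x x′) (□-sign-horizontal x′ u≢u′) ⟩
    orderSign x x′ ⊕ (orderSign u u′ ⊕ c x′ ⊕ sign w)
      ≡⟨ cong (λ z → orderSign x x′ ⊕ (orderSign u u′ ⊕ z ⊕ sign w)) (c-proper r₂) ⟩
    orderSign x x′ ⊕ (orderSign u u′ ⊕ c x ⁻¹ ⊕ sign w)
      ≡⟨ ⊕-exchange-⁻¹ (orderSign u u′) (orderSign x x′) (c x) (sign w) ⟩
    (orderSign u u′ ⊕ c x ⊕ (orderSign x x′ ⊕ sign w)) ⁻¹
      ≡⟨ cong₂ (λ s t → (s ⊕ (t ⊕ sign w)) ⁻¹)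
               (□-sign-horizontal x u≢u′) (□-sign-vertical u′ x x′) ⟨
    (□-sign (u , x) (u′ , x) ⊕ (□-sign (u′ , x) (u′ , x′) ⊕ sign w)) ⁻¹
      ∎
    where
    open ≡-Reasoning
    u≢u′ = Adj⇒≢ G₁ r₁

  module _ (s : Fin a × Fin b → ℕ) (s≥2 : ∀ v → 2 ≤ s v) where

    open MultOrientation s s≥2

    reach-all-copies-□ : ∀ {k l u v x y} → 2 ≤ k → 2 ≤ l → (∀ p → ∃ (Adj (G₁ □ G₂) p)) →
                         Reach (Adj G₁) k u v → Reach (Adj G₂) l x y →
                         ∀ i j → Reach Arc (k + l) ((u , x) , i) ((v , y) , j)
    reach-all-copies-□ {l = l} 2≤k 2≤l hasNeighbour here w₂ =
      reach-all-copies-by-backtracking hasNeighbour (Reach-□ʳ G₁ G₂ _ w₂)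
        (+-monoˡ-≤ l 2≤k) (+-mono-≤ 2≤k 2≤l)
    reach-all-copies-□ {k = k} 2≤k 2≤l hasNeighbour w₁@(step _ _) here =
      reach-all-copies-by-backtracking hasNeighbour (Reach-□ˡ G₁ G₂ _ w₁)
        (≤-trans (≤-reflexive (+-comm 2 k)) (+-monoʳ-≤ k 2≤l)) (+-mono-≤ 2≤k 2≤l)
    reach-all-copies-□ _ _ _ (step {k = k} r₁ w₁) (step {k = l} r₂ w₂) =
      reach-all-copies (inj₂ (r₁ , refl)) (step (inj₁ (refl , r₂)) w)
                       (inj₁ (refl , r₂)) (step (inj₂ (r₁ , refl)) w)
                       length≤ length≤ (sign-exchange r₁ r₂ w)
      where
      w = Reach-trans (Reach-□ˡ G₁ G₂ _ w₁) (Reach-□ʳ G₁ G₂ _ w₂)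
      length≤ : suc (suc (k + l)) ≤ suc k + suc l
      length≤ = s≤s (≤-reflexive (sym (+-suc k l)))

Mult-□-InC₀ : ∀ {a b k l} (G₁ : Graph (Fin a)) (G₂ : Graph (Fin b)) {c : Fin b → Parity} →
              IsProperColouring G₂ c → 2 ≤ k → 2 ≤ l → HasDiam G₁ k → HasDiam G₂ l →
              (s : Fin a × Fin b → ℕ) → (∀ v → 2 ≤ s v) → InC₀ (G₁ □ G₂) s
Mult-□-InC₀ G₁ G₂ c-proper 2≤k@(s≤s _) 2≤l@(s≤s _) diam₁ diam₂ s s≥2 =
  orientation⇒InC₀ (G₁ □ G₂) s≥2 (HasDiam-□ G₁ G₂ diam₁ diam₂) Arc Arc-isOrientation
    λ { ((u , x) , i) ((v , y) , j) →
        reach-all-copies-□ s s≥2 2≤k 2≤l hasNeighbour (proj₁ diam₁ u v) (proj₁ diam₂ x y) i j }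
  where
  open ProductSign G₁ G₂ c-proper
  open MultOrientation s s≥2
  hasNeighbour : ∀ p → ∃ (Adj (G₁ □ G₂) p)
  hasNeighbour (u , x) = let y , r = neighbour G₂ diam₂ x in (u , y) , inj₁ (refl , r)

theorem1p7 : (lam mu a b : ℕ) → 2 ≤ lam → 3 ≤ mu →
    (T₁ : Graph (Fin a)) (T₂ : Graph (Fin b)) →
    IsTree T₁ → IsTree T₂ → HasDiam T₁ lam → HasDiam T₂ mu →
    (s : Fin a × Fin b → ℕ) → (∀ v → 2 ≤ s v) →
    InC₀ (T₁ □ T₂) s
theorem1p7 lam mu a b 2≤lam 3≤mu T₁ T₂ _ tree₂ diam₁ diam₂ s s≥2 =
  Mult-□-InC₀ T₁ T₂ (proj₂ (tree-colouring T₂ tree₂)) 2≤lam (≤-trans (n≤1+n 2) 3≤mu)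
              diam₁ diam₂ s s≥2
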